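{- For integers $n\ge i\ge 0$, let $H_{n,i}$ be the number of G-Motzkin paths of length $n$ with exactly $i$ $\mathbf{h}$-steps. Then for every integer $n\ge 0$, \[ \sum_{i=0}^{n}(-2)^{i}H_{n,i}=(-1)^{n}. \]
   Context: A G-Motzkin path of length $n$ is a lattice path from $(0,0)$ to $(n,0)$ that never goes below the $x$-axis and consists of up steps $\mathbf{u}=(1,1)$, down steps $\mathbf{d}=(1,-1)$, horizontal steps $\mathbf{h}=(1,0)$ and vertical steps $\mathbf{v}=(0,-1)$. -}

module Defs where

open import Data.Nat using (ℕ; zero; suc; _+_; _*_; _≡ᵇ_)
open import Data.Bool using (Bool; true; false; _∧_)
open import Data.List using (List; []; _∷_; length; filterᵇ; map; concatMap; upTo; foldr)
open import Data.Integer as ℤ using (ℤ)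

data Step : Set where
  u d h v : Step   -- u=(1,1), d=(1,-1), h=(1,0), v=(0,-1)

validFrom : ℕ → List Step → Bool
validFrom zero    []       = true
validFrom (suc _) []       = false
validFrom ht      (u ∷ s)  = validFrom (suc ht) s
validFrom zero    (d ∷ s)  = false
validFrom (suc k) (d ∷ s)  = validFrom k s
validFrom ht      (h ∷ s)  = validFrom ht s
validFrom zero    (v ∷ s)  = false
validFrom (suc k) (v ∷ s)  = validFrom k s

isGMotzkin : List Step → Bool
isGMotzkin = validFrom 0

-- Length of a path = x-coordinate of its endpoint (v-steps have width 0).
pathLength : List Step → ℕ
pathLength []      = 0
pathLength (v ∷ s) = pathLength s
pathLength (_ ∷ s) = suc (pathLength s)

hCount : List Step → ℕ
hCount []      = 0
hCount (h ∷ s) = suc (hCount s)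
hCount (_ ∷ s) = hCount s

words : ℕ → List (List Step)
words zero    = [] ∷ []
words (suc k) = concatMap (λ w → (u ∷ w) ∷ (d ∷ w) ∷ (h ∷ w) ∷ (v ∷ w) ∷ []) (words k)

-- All step lists with at most m steps (each listed exactly once).
wordsUpTo : ℕ → List (List Step)
wordsUpTo m = concatMap words (upTo (suc m))

-- A G-Motzkin path of length n has at most 2n steps (#v ≤ #u ≤ n), so
-- enumerating all step lists with at most 2n steps finds all of them.
H : ℕ → ℕ → ℕ
H n i = length (filterᵇ (λ w → isGMotzkin w ∧ (pathLength w ≡ᵇ n) ∧ (hCount w ≡ᵇ i))
                        (wordsUpTo (2 * n)))

sumTo : ℕ → (ℕ → ℤ) → ℤ
sumTo n f = foldr ℤ._+_ (ℤ.+ 0) (map f (upTo (suc n)))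

-- Let F(t, n) be the signed count Σ (-2)^#h over G-Motzkin-type paths of length n from
-- height t down to the x-axis. Splitting off the first step gives
--   F(0, n+1) = F(1, n) - 2 F(0, n),
--   F(t+1, n+1) = F(t+2, n) + F(t, n) - 2 F(t+1, n) + F(t, n+1),
-- with F(t, 0) = 1 (only v-steps). By induction F(t, n) = (-1)^n for every t, and the
-- theorem is the case t = 0. A path of length n from height t has at most 2n + t steps,
-- so it suffices to enumerate the step lists of at most that many steps.
module Submission where

open import Defs
open import Data.Nat using (ℕ)
open import Data.Integer using (ℤ; +_; -[1+_]; _*_; _^_)
open import Relation.Binary.PropositionalEquality using (_≡_)

open import Data.Bool using (Bool; true; false; T; if_then_else_; _∧_)
open import Data.Bool.Properties using (∧-zeroʳ)
open import Data.Integer using (_+_; 0ℤ; 1ℤ)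
open import Data.Integer.Properties using (+-identityʳ; +-identityˡ; +-assoc; *-identityʳ; *-zeroʳ; *-distribˡ-+)
open import Data.Integer.Tactic.RingSolver using (solve-∀)
open import Data.List using (List; []; _∷_; _++_; length; filterᵇ; map; concatMap; foldr; upTo)
open import Data.List.Properties using (map-applyUpTo; map-upTo)
open import Data.Nat as ℕ using (zero; suc; _≤_; z≤n; s≤s; _≡ᵇ_)
open import Data.Nat.Properties using (≤-trans; ≤-reflexive; n≤1+n; +-monoʳ-≤; +-suc; ≡ᵇ⇒≡)
import Data.Nat.Tactic.RingSolver as ℕ-Solver
open import Function using (_∘_)
open import Relation.Binary.PropositionalEquality using (refl; sym; trans; cong; cong₂; subst)
open Relation.Binary.PropositionalEquality.≡-Reasoning

private variable
  A B : Set

∑ : List A → (A → ℤ) → ℤ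
∑ xs f = foldr _+_ 0ℤ (map f xs)

∑-cong : ∀ xs {f g : A → ℤ} → (∀ x → f x ≡ g x) → ∑ xs f ≡ ∑ xs g
∑-cong []       e = refl
∑-cong (x ∷ xs) e = cong₂ _+_ (e x) (∑-cong xs e)

∑-zero : ∀ xs {f : A → ℤ} → (∀ x → f x ≡ 0ℤ) → ∑ xs f ≡ 0ℤ
∑-zero []       e = refl
∑-zero (x ∷ xs) e = cong₂ _+_ (e x) (∑-zero xs e)

∑-++ : ∀ xs ys (f : A → ℤ) → ∑ (xs ++ ys) f ≡ ∑ xs f + ∑ ys f
∑-++ []       ys f = sym (+-identityˡ _)
∑-++ (x ∷ xs) ys f = trans (cong (_+_ (f x)) (∑-++ xs ys f)) (sym (+-assoc (f x) _ _))

∑-+ : ∀ xs (f g : A → ℤ) → ∑ xs (λ x → f x + g x) ≡ ∑ xs f + ∑ xs g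
∑-+ []       f g = refl
∑-+ (x ∷ xs) f g = trans (cong (_+_ (f x + g x)) (∑-+ xs f g)) (interchange (f x) (g x) _ _)
  where
  interchange : ∀ a b c d → a + b + (c + d) ≡ a + c + (b + d)
  interchange = solve-∀

∑-*ˡ : ∀ xs c (f : A → ℤ) → ∑ xs (λ x → c * f x) ≡ c * ∑ xs f
∑-*ˡ []       c f = sym (*-zeroʳ c)
∑-*ˡ (x ∷ xs) c f = trans (cong (_+_ (c * f x)) (∑-*ˡ xs c f)) (sym (*-distribˡ-+ c (f x) _))

∑-concatMap : ∀ (g : B → List A) bs (f : A → ℤ) →
              ∑ (concatMap g bs) f ≡ ∑ bs (λ b → ∑ (g b) f)
∑-concatMap g []       f = refl
∑-concatMap g (b ∷ bs) f = trans (∑-++ (g b) _ f) (cong (_+_ (∑ (g b) f)) (∑-concatMap g bs f))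

∑-comm : ∀ xs (ys : List B) (f : A → B → ℤ) →
         ∑ xs (λ x → ∑ ys (f x)) ≡ ∑ ys (λ y → ∑ xs (λ x → f x y))
∑-comm []       ys f = sym (∑-zero ys (λ _ → refl))
∑-comm (x ∷ xs) ys f = trans (cong (_+_ (∑ ys (f x))) (∑-comm xs ys f)) (sym (∑-+ ys (f x) _))

∑-upTo-suc : ∀ n (f : ℕ → ℤ) → ∑ (upTo (suc n)) f ≡ f 0 + ∑ (upTo n) (f ∘ suc)
∑-upTo-suc n f =
  cong (λ xs → f 0 + foldr _+_ 0ℤ xs) (trans (map-applyUpTo suc f n) (sym (map-upTo (f ∘ suc) n)))

indicator : Bool → ℤ
indicator true  = 1ℤ
indicator false = 0ℤ

length-filterᵇ : ∀ (P : A → Bool) xs → + length (filterᵇ P xs) ≡ ∑ xs (indicator ∘ P)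
length-filterᵇ P []       = refl
length-filterᵇ P (x ∷ xs) with P x
... | true  = cong (_+_ (1ℤ)) (length-filterᵇ P xs)
... | false = trans (length-filterᵇ P xs) (sym (+-identityˡ _))

∑-upTo-indicator : ∀ n c (f : ℕ → ℤ) → c ≤ n →
                   ∑ (upTo (suc n)) (λ i → f i * indicator (c ≡ᵇ i)) ≡ f c
∑-upTo-indicator n zero f _ = begin
  ∑ (upTo (suc n)) (λ i → f i * indicator (0 ≡ᵇ i))
    ≡⟨ ∑-upTo-suc n (λ i → f i * indicator (0 ≡ᵇ i)) ⟩
  f 0 * 1ℤ + ∑ (upTo n) (λ i → f (suc i) * 0ℤ)
    ≡⟨ cong₂ _+_ (*-identityʳ (f 0)) (∑-zero (upTo n) (*-zeroʳ ∘ f ∘ suc)) ⟩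
  f 0 + 0ℤ
    ≡⟨ +-identityʳ (f 0) ⟩
  f 0 ∎
∑-upTo-indicator (suc n) (suc c) f (s≤s c≤n) = begin
  ∑ (upTo (suc (suc n))) (λ i → f i * indicator (suc c ≡ᵇ i))
    ≡⟨ ∑-upTo-suc (suc n) (λ i → f i * indicator (suc c ≡ᵇ i)) ⟩
  f 0 * 0ℤ + ∑ (upTo (suc n)) (λ i → f (suc i) * indicator (c ≡ᵇ i))
    ≡⟨ cong₂ _+_ (*-zeroʳ (f 0)) (∑-upTo-indicator n c (f ∘ suc) c≤n) ⟩
  0ℤ + f (suc c)
    ≡⟨ +-identityˡ _ ⟩
  f (suc c) ∎

∑-wordsUpTo-suc : ∀ K (f : List Step → ℤ) →
  ∑ (wordsUpTo (suc K)) f ≡ f [] + ∑ (wordsUpTo K) (λ w → f (u ∷ w) + f (d ∷ w) + f (h ∷ w) + f (v ∷ w))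
∑-wordsUpTo-suc K f = begin
  ∑ (wordsUpTo (suc K)) f
    ≡⟨ ∑-concatMap words (upTo (suc (suc K))) f ⟩
  ∑ (upTo (suc (suc K))) (λ k → ∑ (words k) f)
    ≡⟨ ∑-upTo-suc (suc K) (λ k → ∑ (words k) f) ⟩
  f [] + 0ℤ + ∑ (upTo (suc K)) (λ k → ∑ (words (suc k)) f)
    ≡⟨ cong₂ _+_ (+-identityʳ (f [])) (∑-cong (upTo (suc K)) firstStep) ⟩
  f [] + ∑ (upTo (suc K)) (λ k → ∑ (words k) extend)
    ≡˘⟨ cong (_+_ (f [])) (∑-concatMap words (upTo (suc K)) extend) ⟩
  f [] + ∑ (wordsUpTo K) extend ∎
  where
  extend : List Step → ℤ
  extend w = f (u ∷ w) + f (d ∷ w) + f (h ∷ w) + f (v ∷ w)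
  reassoc : ∀ a b c e → a + (b + (c + (e + 0ℤ))) ≡ a + b + c + e
  reassoc = solve-∀
  firstStep : ∀ k → ∑ (words (suc k)) f ≡ ∑ (words k) extend
  firstStep k = trans (∑-concatMap _ (words k) f)
                      (∑-cong (words k) (λ w → reassoc (f (u ∷ w)) (f (d ∷ w)) (f (h ∷ w)) (f (v ∷ w))))

hCount≤pathLength : ∀ w → hCount w ≤ pathLength w
hCount≤pathLength []      = z≤n
hCount≤pathLength (u ∷ w) = ≤-trans (hCount≤pathLength w) (n≤1+n _)
hCount≤pathLength (d ∷ w) = ≤-trans (hCount≤pathLength w) (n≤1+n _)
hCount≤pathLength (h ∷ w) = s≤s (hCount≤pathLength w)
hCount≤pathLength (v ∷ w) = hCount≤pathLength w

weight : ℕ → ℕ → List Step → ℤ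
weight ht n w = if validFrom ht w ∧ (pathLength w ≡ᵇ n) then -[1+ 1 ] ^ hCount w else 0ℤ

weight-u-zero : ∀ ht w → weight ht 0 (u ∷ w) ≡ 0ℤ
weight-u-zero zero     w rewrite ∧-zeroʳ (validFrom 1 w) = refl
weight-u-zero (suc ht) w rewrite ∧-zeroʳ (validFrom (suc (suc ht)) w) = refl

weight-d-zero : ∀ ht w → weight (suc ht) 0 (d ∷ w) ≡ 0ℤ
weight-d-zero ht w rewrite ∧-zeroʳ (validFrom ht w) = refl

weight-h-zero : ∀ ht w → weight ht 0 (h ∷ w) ≡ 0ℤ
weight-h-zero zero     w rewrite ∧-zeroʳ (validFrom 0 w) = refl
weight-h-zero (suc ht) w rewrite ∧-zeroʳ (validFrom (suc ht) w) = refl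

weight-u-suc : ∀ ht n w → weight ht (suc n) (u ∷ w) ≡ weight (suc ht) n w
weight-u-suc zero     n w = refl
weight-u-suc (suc ht) n w = refl

weight-h-suc : ∀ ht n w → weight ht (suc n) (h ∷ w) ≡ -[1+ 1 ] * weight ht n w
weight-h-suc zero     n w with validFrom 0 w ∧ (pathLength w ≡ᵇ n)
... | true  = refl
... | false = refl
weight-h-suc (suc ht) n w with validFrom (suc ht) w ∧ (pathLength w ≡ᵇ n)
... | true  = refl
... | false = refl

weightedCount : ℕ → ℕ → ℕ → ℤ
weightedCount ht n K = ∑ (wordsUpTo K) (weight ht n)

weightedCount-zero-zero : ∀ K → weightedCount 0 0 K ≡ 1ℤ
weightedCount-zero-zero zero    = refl
weightedCount-zero-zero (suc K) = begin
  weightedCount 0 0 (suc K)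
    ≡⟨ ∑-wordsUpTo-suc K (weight 0 0) ⟩
  1ℤ + ∑ (wordsUpTo K) (λ w → weight 0 0 (u ∷ w) + 0ℤ + weight 0 0 (h ∷ w) + 0ℤ)
    ≡⟨ cong (_+_ 1ℤ) (∑-zero (wordsUpTo K) vanish) ⟩
  1ℤ ∎
  where
  vanish : ∀ w → weight 0 0 (u ∷ w) + 0ℤ + weight 0 0 (h ∷ w) + 0ℤ ≡ 0ℤ
  vanish w = cong₂ (λ a b → a + 0ℤ + b + 0ℤ) (weight-u-zero 0 w) (weight-h-zero 0 w)

weightedCount-suc-zero : ∀ ht K → weightedCount (suc ht) 0 (suc K) ≡ weightedCount ht 0 K
weightedCount-suc-zero ht K = begin
  weightedCount (suc ht) 0 (suc K)
    ≡⟨ ∑-wordsUpTo-suc K (weight (suc ht) 0) ⟩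
  0ℤ + ∑ (wordsUpTo K) (λ w → weight (suc ht) 0 (u ∷ w) + weight (suc ht) 0 (d ∷ w)
                              + weight (suc ht) 0 (h ∷ w) + weight ht 0 w)
    ≡⟨ +-identityˡ _ ⟩
  ∑ (wordsUpTo K) (λ w → weight (suc ht) 0 (u ∷ w) + weight (suc ht) 0 (d ∷ w)
                         + weight (suc ht) 0 (h ∷ w) + weight ht 0 w)
    ≡⟨ ∑-cong (wordsUpTo K) vanish ⟩
  weightedCount ht 0 K ∎
  where
  vanish : ∀ w → weight (suc ht) 0 (u ∷ w) + weight (suc ht) 0 (d ∷ w)
                 + weight (suc ht) 0 (h ∷ w) + weight ht 0 w ≡ weight ht 0 w
  vanish w = trans (cong (_+ weight ht 0 w) (cong₂ _+_ (cong₂ _+_ (weight-u-zero (suc ht) w) (weight-d-zero ht w))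
                                                       (weight-h-zero (suc ht) w)))
                   (+-identityˡ (weight ht 0 w))

weightedCount-zero-suc : ∀ m K →
  weightedCount 0 (suc m) (suc K) ≡ weightedCount 1 m K + -[1+ 1 ] * weightedCount 0 m K
weightedCount-zero-suc m K = begin
  weightedCount 0 (suc m) (suc K)
    ≡⟨ ∑-wordsUpTo-suc K (weight 0 (suc m)) ⟩
  0ℤ + ∑ ws (λ w → weight 0 (suc m) (u ∷ w) + 0ℤ + weight 0 (suc m) (h ∷ w) + 0ℤ)
    ≡⟨ +-identityˡ _ ⟩
  ∑ ws (λ w → weight 0 (suc m) (u ∷ w) + 0ℤ + weight 0 (suc m) (h ∷ w) + 0ℤ)
    ≡⟨ ∑-cong ws firstStep ⟩
  ∑ ws (λ w → up w + -[1+ 1 ] * level w)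
    ≡⟨ ∑-+ ws up (λ w → -[1+ 1 ] * level w) ⟩
  ∑ ws up + ∑ ws (λ w → -[1+ 1 ] * level w)
    ≡⟨ cong (_+_ (∑ ws up)) (∑-*ˡ ws -[1+ 1 ] level) ⟩
  ∑ ws up + -[1+ 1 ] * ∑ ws level ∎
  where
  ws : List (List Step)
  ws = wordsUpTo K
  up level : List Step → ℤ
  up    = weight 1 m
  level = weight 0 m
  drop-zeros : ∀ a b → a + 0ℤ + b + 0ℤ ≡ a + b
  drop-zeros = solve-∀
  firstStep : ∀ w → weight 0 (suc m) (u ∷ w) + 0ℤ + weight 0 (suc m) (h ∷ w) + 0ℤ ≡ up w + -[1+ 1 ] * level w
  firstStep w = trans (cong₂ (λ a b → a + 0ℤ + b + 0ℤ) (weight-u-suc 0 m w) (weight-h-suc 0 m w))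
                      (drop-zeros (up w) (-[1+ 1 ] * level w))

weightedCount-suc-suc : ∀ ht m K →
  weightedCount (suc ht) (suc m) (suc K) ≡
    weightedCount (suc (suc ht)) m K + weightedCount ht m K
    + -[1+ 1 ] * weightedCount (suc ht) m K + weightedCount ht (suc m) K
weightedCount-suc-suc ht m K = begin
  weightedCount (suc ht) (suc m) (suc K)
    ≡⟨ ∑-wordsUpTo-suc K (weight (suc ht) (suc m)) ⟩
  0ℤ + ∑ ws (λ w → weight (suc ht) (suc m) (u ∷ w) + down w + weight (suc ht) (suc m) (h ∷ w) + level′ w)
    ≡⟨ +-identityˡ _ ⟩
  ∑ ws (λ w → weight (suc ht) (suc m) (u ∷ w) + down w + weight (suc ht) (suc m) (h ∷ w) + level′ w)
    ≡⟨ ∑-cong ws (λ w → cong₂ (λ a b → a + down w + b + level′ w)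
                              (weight-u-suc (suc ht) m w) (weight-h-suc (suc ht) m w)) ⟩
  ∑ ws (λ w → up w + down w + -[1+ 1 ] * level w + level′ w)
    ≡⟨ ∑-+ ws (λ w → up w + down w + -[1+ 1 ] * level w) level′ ⟩
  ∑ ws (λ w → up w + down w + -[1+ 1 ] * level w) + ∑ ws level′
    ≡⟨ cong (_+ ∑ ws level′) (∑-+ ws (λ w → up w + down w) (λ w → -[1+ 1 ] * level w)) ⟩
  ∑ ws (λ w → up w + down w) + ∑ ws (λ w → -[1+ 1 ] * level w) + ∑ ws level′
    ≡⟨ cong (_+ ∑ ws level′) (cong₂ _+_ (∑-+ ws up down) (∑-*ˡ ws -[1+ 1 ] level)) ⟩
  ∑ ws up + ∑ ws down + -[1+ 1 ] * ∑ ws level + ∑ ws level′ ∎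
  where
  ws : List (List Step)
  ws = wordsUpTo K
  up down level level′ : List Step → ℤ
  up     = weight (suc (suc ht)) m
  down   = weight ht m
  level  = weight (suc ht) m
  level′ = weight ht (suc m)

budget-suc : ∀ m x → m ℕ.+ suc m ℕ.+ x ≡ m ℕ.+ m ℕ.+ suc x
budget-suc = ℕ-Solver.solve-∀

budget-mono : ∀ m {a b K} → a ≤ b → m ℕ.+ m ℕ.+ b ≤ K → m ℕ.+ m ℕ.+ a ≤ K
budget-mono m a≤b = ≤-trans (+-monoʳ-≤ (m ℕ.+ m) a≤b)

-- The hypothesis n + n + ht ≤ K says that K steps suffice for every path of length n
-- from height ht: at most n u/d/h-steps and at most n + ht v-steps.
weightedCount-closed : ∀ K ht n → n ℕ.+ n ℕ.+ ht ≤ K → weightedCount ht n K ≡ -[1+ 0 ] ^ n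
weightedCount-closed K       zero     zero    _       = weightedCount-zero-zero K
weightedCount-closed (suc K) (suc ht) zero    (s≤s l) =
  trans (weightedCount-suc-zero ht K) (weightedCount-closed K ht zero l)
weightedCount-closed (suc K) zero     (suc m) (s≤s l) = begin
  weightedCount 0 (suc m) (suc K)
    ≡⟨ weightedCount-zero-suc m K ⟩
  weightedCount 1 m K + -[1+ 1 ] * weightedCount 0 m K
    ≡⟨ cong₂ _+_ (weightedCount-closed K 1 m l′)
                 (cong (-[1+ 1 ] *_) (weightedCount-closed K 0 m (budget-mono m z≤n l′))) ⟩
  s + -[1+ 1 ] * s
    ≡⟨ collect s ⟩
  -[1+ 0 ] * s ∎
  where
  s : ℤ
  s = -[1+ 0 ] ^ m
  l′ : m ℕ.+ m ℕ.+ 1 ≤ K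
  l′ = subst (_≤ K) (budget-suc m 0) l
  collect : ∀ x → x + -[1+ 1 ] * x ≡ -[1+ 0 ] * x
  collect = solve-∀
weightedCount-closed (suc K) (suc ht) (suc m) (s≤s l) = begin
  weightedCount (suc ht) (suc m) (suc K)
    ≡⟨ weightedCount-suc-suc ht m K ⟩
  weightedCount (suc (suc ht)) m K + weightedCount ht m K
    + -[1+ 1 ] * weightedCount (suc ht) m K + weightedCount ht (suc m) K
    ≡⟨ cong₂ _+_ (cong₂ _+_ (cong₂ _+_ (weightedCount-closed K (suc (suc ht)) m l′)
                                       (weightedCount-closed K ht m (budget-mono m ht≤2+ht l′)))
                            (cong (-[1+ 1 ] *_) (weightedCount-closed K (suc ht) m (budget-mono m (n≤1+n _) l′))))
                 (weightedCount-closed K ht (suc m) (subst (_≤ K) (+-suc (m ℕ.+ suc m) ht) l)) ⟩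
  s + s + -[1+ 1 ] * s + -[1+ 0 ] * s
    ≡⟨ cancel s (-[1+ 0 ] * s) ⟩
  -[1+ 0 ] * s ∎
  where
  s : ℤ
  s = -[1+ 0 ] ^ m
  l′ : m ℕ.+ m ℕ.+ suc (suc ht) ≤ K
  l′ = subst (_≤ K) (budget-suc m (suc ht)) l
  ht≤2+ht : ht ≤ suc (suc ht)
  ht≤2+ht = ≤-trans (n≤1+n ht) (n≤1+n (suc ht))
  cancel : ∀ x y → x + x + -[1+ 1 ] * x + y ≡ y
  cancel = solve-∀

weight-as-∑ : ∀ n w →
  ∑ (upTo (suc n)) (λ i → -[1+ 1 ] ^ i * indicator (isGMotzkin w ∧ (pathLength w ≡ᵇ n) ∧ (hCount w ≡ᵇ i)))
    ≡ weight 0 n w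
weight-as-∑ n w with isGMotzkin w | pathLength w ≡ᵇ n in length≡n
... | false | _     = ∑-zero (upTo (suc n)) (λ i → *-zeroʳ (-[1+ 1 ] ^ i))
... | true  | false = ∑-zero (upTo (suc n)) (λ i → *-zeroʳ (-[1+ 1 ] ^ i))
... | true  | true  = ∑-upTo-indicator n (hCount w) (-[1+ 1 ] ^_)
  (≤-trans (hCount≤pathLength w) (≤-reflexive (≡ᵇ⇒≡ (pathLength w) n (subst T (sym length≡n) _))))

theorem2p5 : (n : ℕ) → sumTo n (λ i → (-[1+ 1 ] ^ i) * (+ H n i)) ≡ (-[1+ 0 ] ^ n)
theorem2p5 n = begin
  sumTo n (λ i → -[1+ 1 ] ^ i * + H n i)
    ≡⟨ ∑-cong (upTo (suc n)) (λ i → trans (cong (-[1+ 1 ] ^ i *_) (length-filterᵇ (isPath i) paths))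
                                        (sym (∑-*ˡ paths (-[1+ 1 ] ^ i) (indicator ∘ isPath i)))) ⟩
  ∑ (upTo (suc n)) (λ i → ∑ paths (λ w → -[1+ 1 ] ^ i * indicator (isPath i w)))
    ≡⟨ ∑-comm (upTo (suc n)) paths (λ i w → -[1+ 1 ] ^ i * indicator (isPath i w)) ⟩
  ∑ paths (λ w → ∑ (upTo (suc n)) (λ i → -[1+ 1 ] ^ i * indicator (isPath i w)))
    ≡⟨ ∑-cong paths (weight-as-∑ n) ⟩
  weightedCount 0 n (2 ℕ.* n)
    ≡⟨ weightedCount-closed (2 ℕ.* n) 0 n (≤-reflexive (twice n)) ⟩
  -[1+ 0 ] ^ n ∎
  where
  paths : List (List Step)
  paths = wordsUpTo (2 ℕ.* n)
  isPath : ℕ → List Step → Bool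
  isPath i w = isGMotzkin w ∧ (pathLength w ≡ᵇ n) ∧ (hCount w ≡ᵇ i)
  twice : ∀ m → m ℕ.+ m ℕ.+ 0 ≡ 2 ℕ.* m
  twice = ℕ-Solver.solve-∀
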